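{- Let $N\ge 1$ be an integer, let $1\le N'\le N$, and let $c_1,\dots,c_{N'}\in\{1,2\}$ be arbitrary labels (item $i$ "satisfies $C_1$" if $c_i=1$ and "satisfies $C_2$" if $c_i=2$). Define $\tau_0=2^{N+2}$, $\rho_0=2^{N+3}$, and for $i=1,\dots,N'$: $x_i=\frac{\tau_{i-1}+\rho_{i-1}}{2}$; if $c_i=1$ then $\tau_i=\tau_{i-1}$, $\rho_i=x_i$; if $c_i=2$ then $\tau_i=x_i$, $\rho_i=\rho_{i-1}$. Then for every $1\le i\le N'$: $\rho_i\le\rho_{i-1}$, $\tau_i\ge\tau_{i-1}$, $\rho_i-\tau_i=2^{N+2-i}$, and $x_i$ is an integer. Moreover, if $c_i=1$ then $x_i\ge \rho_{N'}$, and if $c_i=2$ then $x_i\le\tau_{N'}$.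
   Context: This describes procedure SMALL: an adversary presents at most $N$ items to an online algorithm, item $i$ having size $a_i=\varepsilon\cdot k^{ -x_i}$ for a given rational $0<\varepsilon\le 1$ and integer $k\ge 2$; after the algorithm packs item $i$, exactly one of two conditions $C_1$, $C_2$ (depending on the packing) holds for it, which determines the label $c_i$; the procedure stops after $N'$ items (when a stopping condition first holds, or at $N$ items). The labels may thus be any sequence in $\{1,2\}$. -}

module Defs where

open import Data.Nat using (ℕ; zero; suc; _^_) renaming (_+_ to _+ℕ_)
open import Data.Integer using (ℤ; +_)
open import Data.Rational using (ℚ; _/_; _*_; _+_; 0ℚ)
open import Relation.Binary.PropositionalEquality using (_≡_)
open import Data.Product using (Σ; _×_; _,_; proj₁; proj₂)

data Label : Set where
  C₁ C₂ : Label

pow2 : ℕ → ℚ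
pow2 n = (+ (2 ^ n)) / 1

mid : ℚ → ℚ → ℚ
mid a b = (+ 1 / 2) * (a + b)

step : Label → ℚ × ℚ → ℚ × ℚ
step C₁ (t , r) = t , mid t r
step C₂ (t , r) = mid t r , r

-- Labels are given as a sequence c : ℕ → Label, where  c i  is c_i (i ≥ 1);
-- only c 1, …, c N' are ever used by the statement.
-- state N c i = (τ_i, ρ_i).
state : ℕ → (ℕ → Label) → ℕ → ℚ × ℚ
state N c zero    = pow2 (N +ℕ 2) , pow2 (N +ℕ 3)
state N c (suc i) = step (c (suc i)) (state N c i)

τ : ℕ → (ℕ → Label) → ℕ → ℚ
τ N c i = proj₁ (state N c i)

ρ : ℕ → (ℕ → Label) → ℕ → ℚ
ρ N c i = proj₂ (state N c i)

-- x N c i = x_i = (τ_{i-1} + ρ_{i-1}) / 2 for i ≥ 1 (x_0 is unused, set to 0).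
x : ℕ → (ℕ → Label) → ℕ → ℚ
x N c zero    = 0ℚ
x N c (suc i) = mid (τ N c i) (ρ N c i)

IsInteger : ℚ → Set
IsInteger q = Σ ℤ (λ z → q ≡ (z / 1))

module Submission where

-- The bisection procedure keeps an interval [τ_i, ρ_i] whose left end is an
-- integer and whose length is 2^(N+2-i): initially [2^(N+2), 2^(N+3)] has
-- length 2^(N+2), and each step replaces the interval by one of its halves,
-- so as long as the length stays a power of two (i ≤ N + 2) the midpoint
-- x_i = τ_{i-1} + 2^(N+2-i) is again an integer.
--
-- The theorem then follows: monotonicity and the gap come from the invariant,
-- integrality of x_i because x_i is the left end after a C₂-step, and the
-- bounds on x_i because x_i equals ρ_i (label C₁) or τ_i (label C₂).

open import Defs
open import Data.Nat using (ℕ; zero; suc; _≤_; _∸_; _^_; z≤n; s≤s) renaming (_+_ to _+ℕ_)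
import Data.Nat.Properties as ℕ
open import Data.Integer using (+_) renaming (_+_ to _+ℤ_; _*_ to _*ℤ_)
import Data.Integer.Properties as ℤ
open import Data.Rational using (ℚ; ½; 0ℚ; _/_; _+_; _-_; toℚᵘ) renaming (_≤_ to _≤ℚ_)
import Data.Rational.Properties as ℚ
open import Data.Rational.Unnormalised using (mkℚᵘ; *≡*) renaming (_+_ to _+ᵘ_)
import Data.Rational.Unnormalised.Properties as ℚᵘ
open import Data.Rational.Solver using (module +-*-Solver)
open import Data.Product using (_×_; _,_; proj₁; proj₂)
open import Data.Sum using (inj₁; inj₂)
open import Relation.Binary.Core using (Rel)
open import Relation.Binary.Definitions using (Reflexive; Transitive)
open import Relation.Binary.PropositionalEquality

-- Dividing by 1 embeds ℤ additively into ℚ; checked in the unnormalised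
-- rationals, where z / 1 is literally the fraction z / 1.
/1-homo-+ : ∀ i j → (i +ℤ j) / 1 ≡ i / 1 + j / 1
/1-homo-+ i j = ℚ.toℚᵘ-injective (begin
  toℚᵘ ((i +ℤ j) / 1)          ≈⟨ ℚ.toℚᵘ-fromℚᵘ (mkℚᵘ (i +ℤ j) 0) ⟩
  mkℚᵘ (i +ℤ j) 0               ≈⟨ *≡* integral-sum ⟩
  mkℚᵘ i 0 +ᵘ mkℚᵘ j 0          ≈⟨ ℚᵘ.+-cong (ℚ.toℚᵘ-fromℚᵘ (mkℚᵘ i 0)) (ℚ.toℚᵘ-fromℚᵘ (mkℚᵘ j 0)) ⟨
  toℚᵘ (i / 1) +ᵘ toℚᵘ (j / 1)  ≈⟨ ℚ.toℚᵘ-homo-+ (i / 1) (j / 1) ⟨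
  toℚᵘ (i / 1 + j / 1)          ∎)
  where
  open ℚᵘ.≃-Reasoning
  integral-sum : (i +ℤ j) *ℤ + 1 ≡ (i *ℤ + 1 +ℤ j *ℤ + 1) *ℤ + 1
  integral-sum = cong (_*ℤ + 1) (cong₂ _+ℤ_ (sym (ℤ.*-identityʳ i)) (sym (ℤ.*-identityʳ j)))

IsInteger-+ : ∀ {p q} → IsInteger p → IsInteger q → IsInteger (p + q)
IsInteger-+ (i , refl) (j , refl) = i +ℤ j , sym (/1-homo-+ i j)

pow2-integer : ∀ e → IsInteger (pow2 e)
pow2-integer e = + (2 ^ e) , refl

pow2-nonNeg : ∀ e → 0ℚ ≤ℚ pow2 e
pow2-nonNeg e = ℚ.nonNegative⁻¹ (pow2 e) {{ℚ.normalize-nonNeg (2 ^ e) 1}}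

pow2-suc : ∀ e → pow2 (suc e) ≡ pow2 e + pow2 e
pow2-suc e = begin
  + (2 ^ e +ℕ (2 ^ e +ℕ 0)) / 1  ≡⟨ cong (λ n → + (2 ^ e +ℕ n) / 1) (ℕ.+-identityʳ (2 ^ e)) ⟩
  + (2 ^ e +ℕ 2 ^ e) / 1         ≡⟨ /1-homo-+ (+ (2 ^ e)) (+ (2 ^ e)) ⟩
  pow2 e + pow2 e                ∎
  where open ≡-Reasoning

pow2-halve : ∀ {m i} → suc i ≤ m → pow2 (m ∸ i) ≡ pow2 (m ∸ suc i) + pow2 (m ∸ suc i)
pow2-halve {m} {i} i<m = trans (cong pow2 (ℕ.+-∸-assoc 1 i<m)) (pow2-suc (m ∸ suc i))

p≤p+q : ∀ p {q} → 0ℚ ≤ℚ q → p ≤ℚ p + q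
p≤p+q p {q} 0≤q = subst (_≤ℚ p + q) (ℚ.+-identityʳ p) (ℚ.+-monoʳ-≤ p 0≤q)

mid-of-double : ∀ t g → mid t (t + (g + g)) ≡ t + g
mid-of-double = solve 2 (λ t g → con ½ :* (t :+ (t :+ (g :+ g))) := t :+ g) refl
  where open +-*-Solver

+-minus-left : ∀ t g → (t + g) - t ≡ g
+-minus-left = solve 2 (λ t g → (t :+ g) :- t := g) refl
  where open +-*-Solver

HasGap : ℚ → ℚ × ℚ → Set
HasGap g (t , r) = IsInteger t × r ≡ t + g

gap-length : ∀ {g} S → HasGap g S → proj₂ S - proj₁ S ≡ g
gap-length (t , _) (_ , refl) = +-minus-left t _

step-halves : ∀ l {g} S → IsInteger g → HasGap (g + g) S → HasGap g (step l S)
step-halves C₁ {g} (t , _) _ (t-int , refl) = t-int , mid-of-double t g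
step-halves C₂ {g} (t , _) g-int (t-int , refl) =
  subst IsInteger (sym midpoint) (IsInteger-+ t-int g-int) ,
  trans (sym (ℚ.+-assoc t g g)) (cong (_+ g) (sym midpoint))
  where
  midpoint : mid t (t + (g + g)) ≡ t + g
  midpoint = mid-of-double t g

step-mono : ∀ l {g} S → 0ℚ ≤ℚ g → HasGap (g + g) S →
            proj₂ (step l S) ≤ℚ proj₂ S × proj₁ S ≤ℚ proj₁ (step l S)
step-mono C₁ {g} (t , _) 0≤g (_ , refl) =
  subst (_≤ℚ t + (g + g)) (sym (mid-of-double t g)) (ℚ.+-monoʳ-≤ t (p≤p+q g 0≤g)) , ℚ.≤-refl
step-mono C₂ {g} (t , _) 0≤g (_ , refl) =
  ℚ.≤-refl , subst (t ≤ℚ_) (sym (mid-of-double t g)) (p≤p+q t 0≤g)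

antitone-upto : ∀ {a ℓ} {A : Set a} (_≼_ : Rel A ℓ) → Reflexive _≼_ → Transitive _≼_ →
                (f : ℕ → A) (n : ℕ) → (∀ i → suc i ≤ n → f (suc i) ≼ f i) →
                ∀ {j k} → j ≤ k → k ≤ n → f k ≼ f j
antitone-upto _≼_ refl≼ trans≼ f n f-step {j} {zero} z≤n _ = refl≼
antitone-upto _≼_ refl≼ trans≼ f n f-step {j} {suc k} j≤k+1 k+1≤n with ℕ.m≤n⇒m<n∨m≡n j≤k+1
... | inj₂ refl      = refl≼
... | inj₁ (s≤s j≤k) = trans≼ (f-step k k+1≤n)
                              (antitone-upto _≼_ refl≼ trans≼ f n f-step j≤k (ℕ.<⇒≤ k+1≤n))

-- It is proved together with its reading one step
-- earlier: before step i + 1 the gap is twice 2^(N+2-(i+1)).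
state-gap : ∀ N c i → i ≤ N +ℕ 2 → HasGap (pow2 ((N +ℕ 2) ∸ i)) (state N c i)
state-gap-before : ∀ N c i → suc i ≤ N +ℕ 2 →
                   HasGap (pow2 ((N +ℕ 2) ∸ suc i) + pow2 ((N +ℕ 2) ∸ suc i)) (state N c i)

state-gap N c zero _ =
  pow2-integer (N +ℕ 2) , trans (cong pow2 (ℕ.+-suc N 2)) (pow2-suc (N +ℕ 2))
state-gap N c (suc i) i<N+2 =
  step-halves (c (suc i)) (state N c i) (pow2-integer ((N +ℕ 2) ∸ suc i)) (state-gap-before N c i i<N+2)

state-gap-before N c i i<N+2 =
  subst (λ g → HasGap g (state N c i)) (pow2-halve i<N+2) (state-gap N c i (ℕ.<⇒≤ i<N+2))

state-step-mono : ∀ N c i → suc i ≤ N +ℕ 2 →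
                  ρ N c (suc i) ≤ℚ ρ N c i × τ N c i ≤ℚ τ N c (suc i)
state-step-mono N c i i<N+2 =
  step-mono (c (suc i)) (state N c i) (pow2-nonNeg ((N +ℕ 2) ∸ suc i)) (state-gap-before N c i i<N+2)

-- x_i is the left end after a C₂-step, hence an integer.
x-integer : ∀ N c i → suc i ≤ N +ℕ 2 → IsInteger (x N c (suc i))
x-integer N c i i<N+2 =
  proj₁ (step-halves C₂ (state N c i) (pow2-integer ((N +ℕ 2) ∸ suc i)) (state-gap-before N c i i<N+2))

ρ≡x-at-C₁ : ∀ N c i → c (suc i) ≡ C₁ → ρ N c (suc i) ≡ x N c (suc i)
ρ≡x-at-C₁ N c i c≡C₁ rewrite c≡C₁ = refl

τ≡x-at-C₂ : ∀ N c i → c (suc i) ≡ C₂ → τ N c (suc i) ≡ x N c (suc i)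
τ≡x-at-C₂ N c i c≡C₂ rewrite c≡C₂ = refl

-- All indices up to N′ lie within the
-- range i ≤ N + 2 where the invariant holds; the bounds on x_i follow because
-- ρ only decreases and τ only increases from step i to step N′.
lemma2 : (N N′ : ℕ) → 1 ≤ N → 1 ≤ N′ → N′ ≤ N → (c : ℕ → Label) →
         (i : ℕ) → 1 ≤ i → i ≤ N′ →
           (ρ N c i ≤ℚ ρ N c (i ∸ 1))
         × (τ N c (i ∸ 1) ≤ℚ τ N c i)
         × (ρ N c i - τ N c i ≡ pow2 ((N +ℕ 2) ∸ i))
         × IsInteger (x N c i)
         × (c i ≡ C₁ → ρ N c N′ ≤ℚ x N c i)
         × (c i ≡ C₂ → x N c i ≤ℚ τ N c N′)
lemma2 N N′ _ _ N′≤N c (suc j) _ i≤N′ =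
    proj₁ (state-step-mono N c j i≤N+2)
  , proj₂ (state-step-mono N c j i≤N+2)
  , gap-length (state N c (suc j)) (state-gap N c (suc j) i≤N+2)
  , x-integer N c j i≤N+2
  , (λ c≡C₁ → subst (ρ N c N′ ≤ℚ_) (ρ≡x-at-C₁ N c j c≡C₁) ρ-decreasing)
  , (λ c≡C₂ → subst (_≤ℚ τ N c N′) (τ≡x-at-C₂ N c j c≡C₂) τ-increasing)
  where
  N′≤N+2 : N′ ≤ N +ℕ 2
  N′≤N+2 = ℕ.≤-trans N′≤N (ℕ.m≤m+n N 2)
  i≤N+2 : suc j ≤ N +ℕ 2
  i≤N+2 = ℕ.≤-trans i≤N′ N′≤N+2
  ρ-decreasing : ρ N c N′ ≤ℚ ρ N c (suc j)
  ρ-decreasing = antitone-upto _≤ℚ_ ℚ.≤-refl ℚ.≤-trans (ρ N c) (N +ℕ 2)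
                   (λ k k<N+2 → proj₁ (state-step-mono N c k k<N+2)) i≤N′ N′≤N+2
  τ-increasing : τ N c (suc j) ≤ℚ τ N c N′
  τ-increasing = antitone-upto (λ p q → q ≤ℚ p) ℚ.≤-refl (λ p≥q q≥r → ℚ.≤-trans q≥r p≥q)
                   (τ N c) (N +ℕ 2) (λ k k<N+2 → proj₂ (state-step-mono N c k k<N+2)) i≤N′ N′≤N+2
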